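{- The logic $\mathbf{CL}(\{\top\trianglelefteq p\Rightarrow p,\ p\wedge(p\Rightarrow q)\trianglelefteq q,\ p\trianglelefteq q\Rightarrow p\})$ is sound and complete with respect to the class of selection L-frames $(X,1,\curlywedge,s)$ satisfying $s(x,a)=a\cap{\uparrow}x$ for all $x\in X$ and all filters $a$: a consequence pair belongs to this logic iff it is validated by every such frame.
   Context: Formulas: $\phi::=p\mid\top\mid\bot\mid\phi\wedge\phi\mid\phi\vee\phi\mid\phi\Rightarrow\phi$. $\mathbf{CL}(\Gamma)$ is the smallest set of consequence pairs $\phi\trianglelefteq\psi$ containing $\Gamma$, closed under uniform substitution, containing $p\trianglelefteq\top$, $\bot\trianglelefteq p$, $p\trianglelefteq p$, $p\wedge q\trianglelefteq p$, $p\wedge q\trianglelefteq q$, $p\trianglelefteq p\vee q$, $q\trianglelefteq p\vee q$, $\top\trianglelefteq p\Rightarrow\top$, $p\Rightarrow(q\wedge r)\trianglelefteq(p\Rightarrow q)\wedge(p\Rightarrow r)$, $(p\Rightarrow q)\wedge(p\Rightarrow r)\trianglelefteq p\Rightarrow(q\wedge r)$, closed under transitivity, $\wedge$-introduction (from $r\trianglelefteq p,r\trianglelefteq q$ infer $r\trianglelefteq p\wedge q$), $\vee$-elimination (from $p\trianglelefteq r,q\trianglelefteq r$ infer $p\vee q\trianglelefteq r$), and congruence for $\Rightarrow$ in each argument. A selection L-frame is a meet-semilattice $(X,1,\curlywedge)$ ($x\preccurlyeq y$ iff $x\curlywedge y=x$, ${\uparrow}x=\{y:x\preccurlyeq y\}$)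 with $s:X\times\mathcal F(X)\to\mathcal F(X)$ ($\mathcal F(X)$ the filters: upward closed, closed under finite meets) such that $s(1,a)=\{1\}$; $x\preccurlyeq y$ implies $s(y,a)\subseteq s(x,a)$; if $z\in s(x\curlywedge y,a)$ there are $u\in s(x,a)$, $v\in s(y,a)$ with $u\curlywedge v\preccurlyeq z$. Under a valuation $V$ (letters to filters): $x\Vdash p$ iff $x\in V(p)$; $\top$ always; $x\Vdash\bot$ iff $x=1$; $\wedge$ pointwise; $x\Vdash\phi\vee\psi$ iff some $y\Vdash\phi$, $z\Vdash\psi$ have $y\curlywedge z\preccurlyeq x$; $x\Vdash\phi\Rightarrow\psi$ iff $s(x,[\![\phi]\!])\subseteq[\![\psi]\!]$. A frame validates $\phi\trianglelefteq\psi$ if $[\![\phi]\!]\subseteq[\![\psi]\!]$ for all valuations. -}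

module Defs where

open import Level using (Level; _⊔_; Lift; lift; lower) renaming (suc to lsuc)
open import Data.Nat using (ℕ)
open import Data.Product using (Σ; _×_; _,_; proj₁; proj₂; ∃-syntax)
open import Data.Unit.Polymorphic using (⊤; tt)
open import Algebra.Bundles using (IdempotentCommutativeMonoid)
import Relation.Binary.Reasoning.Setoid as SetoidR

infixr 6 _∧'_
infixr 5 _∨'_
infixr 4 _⇒'_

data Fm : Set where
  var   : ℕ → Fm
  ⊤'    : Fm
  ⊥'    : Fm
  _∧'_  : Fm → Fm → Fm
  _∨'_  : Fm → Fm → Fm
  _⇒'_  : Fm → Fm → Fm

_[_] : Fm → (ℕ → Fm) → Fm
var n [ σ ]    = σ n
⊤' [ σ ]       = ⊤'
⊥' [ σ ]       = ⊥'
(φ ∧' ψ) [ σ ] = (φ [ σ ]) ∧' (ψ [ σ ])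
(φ ∨' ψ) [ σ ] = (φ [ σ ]) ∨' (ψ [ σ ])
(φ ⇒' ψ) [ σ ] = (φ [ σ ]) ⇒' (ψ [ σ ])

p q r : Fm
p = var 0
q = var 1
r = var 2

-- The logic CL(Γ): smallest set of consequence pairs φ ⊴ ψ
-- (here: an inductive relation  CL Γ φ ψ)

data CL (Γ : Fm → Fm → Set) : Fm → Fm → Set where
  axΓ    : ∀ {φ ψ} → Γ φ ψ → CL Γ φ ψ
  sub    : ∀ {φ ψ} (σ : ℕ → Fm) → CL Γ φ ψ → CL Γ (φ [ σ ]) (ψ [ σ ])
  top-ax : CL Γ p ⊤'
  bot-ax : CL Γ ⊥' p
  idax   : CL Γ p p
  ∧-el₁  : CL Γ (p ∧' q) p
  ∧-el₂  : CL Γ (p ∧' q) q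
  ∨-in₁  : CL Γ p (p ∨' q)
  ∨-in₂  : CL Γ q (p ∨' q)
  ⇒-top  : CL Γ ⊤' (p ⇒' ⊤')
  ⇒-∧₁   : CL Γ (p ⇒' (q ∧' r)) ((p ⇒' q) ∧' (p ⇒' r))
  ⇒-∧₂   : CL Γ ((p ⇒' q) ∧' (p ⇒' r)) (p ⇒' (q ∧' r))
  tr     : ∀ {φ ψ χ} → CL Γ φ ψ → CL Γ ψ χ → CL Γ φ χ
  ∧-intro : ∀ {φ ψ χ} → CL Γ χ φ → CL Γ χ ψ → CL Γ χ (φ ∧' ψ)
  ∨-elim  : ∀ {φ ψ χ} → CL Γ φ χ → CL Γ ψ χ → CL Γ (φ ∨' ψ) χ
  ⇒-congˡ : ∀ {φ ψ χ} → CL Γ φ ψ → CL Γ ψ φ → CL Γ (φ ⇒' χ) (ψ ⇒' χ)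
  ⇒-congʳ : ∀ {φ ψ χ} → CL Γ φ ψ → CL Γ ψ φ → CL Γ (χ ⇒' φ) (χ ⇒' ψ)

data Γ₅ : Fm → Fm → Set where
  g-refl : Γ₅ ⊤' (p ⇒' p)
  g-mp   : Γ₅ (p ∧' (p ⇒' q)) q
  g-k    : Γ₅ p (q ⇒' p)

module SemilatticeNotions {c ℓ} (M : IdempotentCommutativeMonoid c ℓ) where
  open IdempotentCommutativeMonoid M renaming (Carrier to X; _∙_ to _⋏_; ε to 𝟙)

  _≼_ : X → X → Set ℓ
  x ≼ y = (x ⋏ y) ≈ x

  ↑ : X → X → Set ℓ
  ↑ x y = x ≼ y

  record Filter : Set (lsuc (c ⊔ ℓ)) where
    field
      _∋_    : X → Set (c ⊔ ℓ)
      up     : ∀ {x y} → _∋_ x → x ≼ y → _∋_ y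
      has-𝟙  : _∋_ 𝟙
      meet   : ∀ {x y} → _∋_ x → _∋_ y → _∋_ (x ⋏ y)
  open Filter public

  _∈F_ : X → Filter → Set (c ⊔ ℓ)
  x ∈F a = a ∋ x

record SelectionLFrame (c ℓ : Level) : Set (lsuc (c ⊔ ℓ)) where
  field
    semilattice : IdempotentCommutativeMonoid c ℓ
  open IdempotentCommutativeMonoid semilattice renaming (Carrier to X; _∙_ to _⋏_; ε to 𝟙)
  open SemilatticeNotions semilattice
  field
    s      : X → Filter → Filter
    s-𝟙    : ∀ a z → (z ∈F s 𝟙 a → z ≈ 𝟙) × (z ≈ 𝟙 → z ∈F s 𝟙 a)
    s-anti : ∀ {x y} a → x ≼ y → ∀ z → z ∈F s y a → z ∈F s x a
    s-meet : ∀ x y a z → z ∈F s (x ⋏ y) a →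
             ∃[ u ] ∃[ v ] (u ∈F s x a × v ∈F s y a × (u ⋏ v) ≼ z)
    -- s is a function of the filter *as a set* (filters are sets in the paper)
    s-ext  : ∀ x a b → (∀ z → (z ∈F a → z ∈F b) × (z ∈F b → z ∈F a)) →
             ∀ z → z ∈F s x a → z ∈F s x b

module Semantics {c ℓ} (F : SelectionLFrame c ℓ) where
  open SelectionLFrame F
  open IdempotentCommutativeMonoid semilattice renaming (Carrier to X; _∙_ to _⋏_; ε to 𝟙)
  open SemilatticeNotions semilattice
  open SetoidR setoid

  private
    ≼-trans : ∀ {x y z} → x ≼ y → y ≼ z → x ≼ z
    ≼-trans {x} {y} {z} xy yz = begin
      x ⋏ z        ≈⟨ ∙-congʳ (sym xy) ⟩
      (x ⋏ y) ⋏ z  ≈⟨ assoc x y z ⟩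
      x ⋏ (y ⋏ z)  ≈⟨ ∙-congˡ yz ⟩
      x ⋏ y        ≈⟨ xy ⟩
      x ∎

    ≼-refl : ∀ {x} → x ≼ x
    ≼-refl {x} = idem x

    ≈⇒≼ : ∀ {x y} → x ≈ y → x ≼ y
    ≈⇒≼ {x} {y} e = trans (∙-congˡ (sym e)) (idem x)

    swap4 : ∀ a b x y → (a ⋏ b) ⋏ (x ⋏ y) ≈ (a ⋏ x) ⋏ (b ⋏ y)
    swap4 a b x y = begin
      (a ⋏ b) ⋏ (x ⋏ y)   ≈⟨ assoc a b (x ⋏ y) ⟩
      a ⋏ (b ⋏ (x ⋏ y))   ≈⟨ ∙-congˡ (sym (assoc b x y)) ⟩
      a ⋏ ((b ⋏ x) ⋏ y)   ≈⟨ ∙-congˡ (∙-congʳ (comm b x)) ⟩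
      a ⋏ ((x ⋏ b) ⋏ y)   ≈⟨ ∙-congˡ (assoc x b y) ⟩
      a ⋏ (x ⋏ (b ⋏ y))   ≈⟨ sym (assoc a x (b ⋏ y)) ⟩
      (a ⋏ x) ⋏ (b ⋏ y) ∎

    ⋏-mono : ∀ {a b x y} → a ≼ x → b ≼ y → (a ⋏ b) ≼ (x ⋏ y)
    ⋏-mono {a} {b} {x} {y} ax by = trans (swap4 a b x y) (∙-cong ax by)

    ≈𝟙-up : ∀ {x y} → x ≈ 𝟙 → x ≼ y → y ≈ 𝟙
    ≈𝟙-up {x} {y} e xy = begin
      y        ≈⟨ sym (identityˡ y) ⟩
      𝟙 ⋏ y    ≈⟨ ∙-congʳ (sym e) ⟩
      x ⋏ y    ≈⟨ xy ⟩
      x        ≈⟨ e ⟩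
      𝟙 ∎

  ⊤F : Filter
  ⊤F = record { _∋_ = λ _ → ⊤ ; up = λ _ _ → tt ; has-𝟙 = tt ; meet = λ _ _ → tt }

  ⊥F : Filter
  ⊥F = record
    { _∋_   = λ x → Lift c (x ≈ 𝟙)
    ; up    = λ e xy → lift (≈𝟙-up (lower e) xy)
    ; has-𝟙 = lift refl
    ; meet  = λ {x} {y} ex ey → lift (trans (∙-cong (lower ex) (lower ey)) (identityˡ 𝟙))
    }

  _∧F_ : Filter → Filter → Filter
  A ∧F B = record
    { _∋_   = λ x → A ∋ x × B ∋ x
    ; up    = λ (a , b) xy → up A a xy , up B b xy
    ; has-𝟙 = has-𝟙 A , has-𝟙 B
    ; meet  = λ (a , b) (a' , b') → meet A a a' , meet B b b'
    }

  _∨F_ : Filter → Filter → Filter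
  A ∨F B = record
    { _∋_   = λ x → ∃[ y ] ∃[ z ] (A ∋ y × B ∋ z × (y ⋏ z) ≼ x)
    ; up    = λ (y , z , a , b , le) xy → y , z , a , b , ≼-trans le xy
    ; has-𝟙 = 𝟙 , 𝟙 , has-𝟙 A , has-𝟙 B , ≈⇒≼ (identityˡ 𝟙)
    ; meet  = λ (y , z , a , b , le) (y' , z' , a' , b' , le') →
                y ⋏ y' , z ⋏ z' , meet A a a' , meet B b b' ,
                ≼-trans (≈⇒≼ (swap4 y y' z z')) (⋏-mono le le')
    }

  _⇒F_ : Filter → Filter → Filter
  A ⇒F B = record
    { _∋_   = λ x → ∀ z → z ∈F s x A → B ∋ z
    ; up    = λ h xy z zs → h z (s-anti A xy z zs)
    ; has-𝟙 = λ z zs → up B (has-𝟙 B) (≈⇒≼ (sym (proj₁ (s-𝟙 A z) zs)))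
    ; meet  = λ {x} {y} hx hy z zs →
                let (u , v , us , vs , le) = s-meet x y A z zs
                in up B (meet B (hx u us) (hy v vs)) le
    }

  Valuation : Set (lsuc (c ⊔ ℓ))
  Valuation = ℕ → Filter

  ⟦_⟧ : Fm → Valuation → Filter
  ⟦ var n ⟧ V  = V n
  ⟦ ⊤' ⟧ V     = ⊤F
  ⟦ ⊥' ⟧ V     = ⊥F
  ⟦ φ ∧' ψ ⟧ V = ⟦ φ ⟧ V ∧F ⟦ ψ ⟧ V
  ⟦ φ ∨' ψ ⟧ V = ⟦ φ ⟧ V ∨F ⟦ ψ ⟧ V
  ⟦ φ ⇒' ψ ⟧ V = ⟦ φ ⟧ V ⇒F ⟦ ψ ⟧ V

  _,_⊩_ : Valuation → X → Fm → Set (c ⊔ ℓ)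
  V , x ⊩ φ = x ∈F ⟦ φ ⟧ V

Validates : ∀ {c ℓ} → SelectionLFrame c ℓ → Fm → Fm → Set (lsuc (c ⊔ ℓ))
Validates F φ ψ = ∀ V x → V , x ⊩ φ → V , x ⊩ ψ
  where open Semantics F

IntersectionFrame : ∀ {c ℓ} → SelectionLFrame c ℓ → Set (lsuc (c ⊔ ℓ))
IntersectionFrame F = ∀ x a z →
    (z ∈F s x a → (z ∈F a × x ≼ z)) × ((z ∈F a × x ≼ z) → z ∈F s x a)
  where
  open SelectionLFrame F
  open SemilatticeNotions semilattice

-- Soundness: the rules of CL hold in every selection L-frame, and once s(x,a) = a ∩ ↑x the three
-- axioms are immediate, since z ∈ s(x,a) means z ∈ a and x ≼ z.
-- Completeness: over Γ₅ the operator ⇒ is residuated with respect to ∧ (a deduction theorem), so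
-- ∧ distributes over ∨. Formulas ordered by reverse provability then form a meet-semilattice with
-- meet ∨ and top ⊥, and with s(x,a) = a ∩ ↑x and the valuation p ↦ {x ∣ x ⊢ p} every formula x
-- forces exactly what it proves; in particular φ forces ψ iff φ ⊢ ψ.
module Submission where

open import Defs
open import Level using (Level; Lift; lift; lower; _⊔_)
open import Data.Nat using (ℕ; zero; suc)
open import Data.Product using (_×_; _,_; proj₁; proj₂)
open import Data.Unit.Polymorphic using (tt)
open import Function.Bundles using (_⇔_; mk⇔; Equivalence)
open import Algebra.Bundles using (IdempotentCommutativeMonoid)

open Equivalence using (to; from)

module Derivable (Γ : Fm → Fm → Set) where

  infix 2 _⊢_
  _⊢_ : Fm → Fm → Set
  _⊢_ = CL Γ

  ⟨_,_,_⟩ : Fm → Fm → Fm → ℕ → Fm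
  ⟨ a , b , c ⟩ zero          = a
  ⟨ a , b , c ⟩ (suc zero)    = b
  ⟨ a , b , c ⟩ (suc (suc _)) = c

  ⊢-refl : ∀ {a} → a ⊢ a
  ⊢-refl {a} = sub ⟨ a , ⊤' , ⊤' ⟩ idax

  ⊢-⊤ : ∀ {a} → a ⊢ ⊤'
  ⊢-⊤ {a} = sub ⟨ a , ⊤' , ⊤' ⟩ top-ax

  ⊥-⊢ : ∀ {a} → ⊥' ⊢ a
  ⊥-⊢ {a} = sub ⟨ a , ⊤' , ⊤' ⟩ bot-ax

  ∧-fst : ∀ {a b} → a ∧' b ⊢ a
  ∧-fst {a} {b} = sub ⟨ a , b , ⊤' ⟩ ∧-el₁

  ∧-snd : ∀ {a b} → a ∧' b ⊢ b
  ∧-snd {a} {b} = sub ⟨ a , b , ⊤' ⟩ ∧-el₂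

  ∨-inl : ∀ {a b} → a ⊢ a ∨' b
  ∨-inl {a} {b} = sub ⟨ a , b , ⊤' ⟩ ∨-in₁

  ∨-inr : ∀ {a b} → b ⊢ a ∨' b
  ∨-inr {a} {b} = sub ⟨ a , b , ⊤' ⟩ ∨-in₂

  ⇒-∧-split : ∀ {a b c} → a ⇒' (b ∧' c) ⊢ (a ⇒' b) ∧' (a ⇒' c)
  ⇒-∧-split {a} {b} {c} = sub ⟨ a , b , c ⟩ ⇒-∧₁

  ⇒-∧-merge : ∀ {a b c} → (a ⇒' b) ∧' (a ⇒' c) ⊢ a ⇒' (b ∧' c)
  ⇒-∧-merge {a} {b} {c} = sub ⟨ a , b , c ⟩ ⇒-∧₂

  ∧-comm : ∀ {a b} → a ∧' b ⊢ b ∧' a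
  ∧-comm = ∧-intro ∧-snd ∧-fst

  ∨-mono : ∀ {a a′ b b′} → a ⊢ a′ → b ⊢ b′ → a ∨' b ⊢ a′ ∨' b′
  ∨-mono a⊢a′ b⊢b′ = ∨-elim (tr a⊢a′ ∨-inl) (tr b⊢b′ ∨-inr)

  -- Only congruence is given for ⇒; monotonicity comes from writing a as a ∧ b up to equivalence.
  ⇒-monoʳ : ∀ {a b c} → a ⊢ b → c ⇒' a ⊢ c ⇒' b
  ⇒-monoʳ a⊢b = tr (⇒-congʳ (∧-intro ⊢-refl a⊢b) ∧-fst) (tr ⇒-∧-split ∧-snd)

open Derivable Γ₅

modus-ponens : ∀ {a b} → a ∧' (a ⇒' b) ⊢ b
modus-ponens {a} {b} = sub ⟨ a , b , ⊤' ⟩ (axΓ g-mp)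

⇒-weaken : ∀ {a b} → a ⊢ b ⇒' a
⇒-weaken {a} {b} = sub ⟨ a , b , ⊤' ⟩ (axΓ g-k)

⊤-⊢-⇒-refl : ∀ {a} → ⊤' ⊢ a ⇒' a
⊤-⊢-⇒-refl {a} = sub ⟨ a , ⊤' , ⊤' ⟩ (axΓ g-refl)

⊢-curry : ∀ {x a b} → x ∧' a ⊢ b → x ⊢ a ⇒' b
⊢-curry x∧a⊢b = tr (∧-intro ⇒-weaken (tr ⊢-⊤ ⊤-⊢-⇒-refl)) (tr ⇒-∧-merge (⇒-monoʳ x∧a⊢b))

⊢-uncurry : ∀ {x a b} → x ⊢ a ⇒' b → x ∧' a ⊢ b
⊢-uncurry x⊢a⇒b = tr (∧-intro ∧-snd (tr ∧-fst x⊢a⇒b)) modus-ponens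

∧-distribˡ-∨ : ∀ {x a b} → x ∧' (a ∨' b) ⊢ (x ∧' a) ∨' (x ∧' b)
∧-distribˡ-∨ = tr ∧-comm (⊢-uncurry (∨-elim (⊢-curry (tr ∧-comm ∨-inl))
                                             (⊢-curry (tr ∧-comm ∨-inr))))

module Soundness {c ℓ} (F : SelectionLFrame c ℓ) where
  open SelectionLFrame F
  open IdempotentCommutativeMonoid semilattice renaming (Carrier to X; _∙_ to _⋏_; ε to 𝟙)
  open SemilatticeNotions semilattice
  open Semantics F

  ≈⇒≼ : ∀ {x y} → x ≈ y → x ≼ y
  ≈⇒≼ {x} e = trans (∙-congˡ (sym e)) (idem x)

  infix 4 _≐_
  _≐_ : Filter → Filter → Set (c ⊔ ℓ)
  a ≐ b = ∀ z → z ∈F a ⇔ z ∈F b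

  s-resp-≐ : ∀ x {a b} → a ≐ b → s x a ≐ s x b
  s-resp-≐ x a≐b z = mk⇔ (s-ext x _ _ (λ w → to (a≐b w) , from (a≐b w)) z)
                         (s-ext x _ _ (λ w → from (a≐b w) , to (a≐b w)) z)

  ⟦⟧-subst : ∀ φ σ V → ⟦ φ [ σ ] ⟧ V ≐ ⟦ φ ⟧ (λ n → ⟦ σ n ⟧ V)
  ⟦⟧-subst (var n)  σ V z = mk⇔ (λ h → h) (λ h → h)
  ⟦⟧-subst ⊤'       σ V z = mk⇔ (λ h → h) (λ h → h)
  ⟦⟧-subst ⊥'       σ V z = mk⇔ (λ h → h) (λ h → h)
  ⟦⟧-subst (φ ∧' ψ) σ V z = mk⇔
    (λ (a , b) → to (⟦⟧-subst φ σ V z) a , to (⟦⟧-subst ψ σ V z) b)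
    (λ (a , b) → from (⟦⟧-subst φ σ V z) a , from (⟦⟧-subst ψ σ V z) b)
  ⟦⟧-subst (φ ∨' ψ) σ V z = mk⇔
    (λ (y , w , a , b , le) → y , w , to (⟦⟧-subst φ σ V y) a , to (⟦⟧-subst ψ σ V w) b , le)
    (λ (y , w , a , b , le) → y , w , from (⟦⟧-subst φ σ V y) a , from (⟦⟧-subst ψ σ V w) b , le)
  ⟦⟧-subst (φ ⇒' ψ) σ V z = mk⇔
    (λ h w w∈s → to (⟦⟧-subst ψ σ V w) (h w (from (s-resp-≐ z (⟦⟧-subst φ σ V) w) w∈s)))
    (λ h w w∈s → from (⟦⟧-subst ψ σ V w) (h w (to (s-resp-≐ z (⟦⟧-subst φ σ V) w) w∈s)))

  CL-sound : ∀ {Γ} → (∀ {φ ψ} → Γ φ ψ → Validates F φ ψ) →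
             ∀ {φ ψ} → CL Γ φ ψ → Validates F φ ψ
  CL-sound Γ-valid (axΓ γ) = Γ-valid γ
  CL-sound Γ-valid (sub {φ} {ψ} σ d) V x x⊩φσ =
    from (⟦⟧-subst ψ σ V x) (CL-sound Γ-valid d _ x (to (⟦⟧-subst φ σ V x) x⊩φσ))
  CL-sound Γ-valid top-ax V x _ = tt
  CL-sound Γ-valid bot-ax V x (lift x≈𝟙) = up (V 0) (has-𝟙 (V 0)) (trans (identityˡ x) x≈𝟙)
  CL-sound Γ-valid idax V x h = h
  CL-sound Γ-valid ∧-el₁ V x (a , b) = a
  CL-sound Γ-valid ∧-el₂ V x (a , b) = b
  CL-sound Γ-valid ∨-in₁ V x h = x , 𝟙 , h , has-𝟙 (V 1) , ≈⇒≼ (identityʳ x)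
  CL-sound Γ-valid ∨-in₂ V x h = 𝟙 , x , has-𝟙 (V 0) , h , ≈⇒≼ (identityˡ x)
  CL-sound Γ-valid ⇒-top V x _ z _ = tt
  CL-sound Γ-valid ⇒-∧₁ V x h = (λ z z∈s → proj₁ (h z z∈s)) , (λ z z∈s → proj₂ (h z z∈s))
  CL-sound Γ-valid ⇒-∧₂ V x (h₁ , h₂) z z∈s = h₁ z z∈s , h₂ z z∈s
  CL-sound Γ-valid (tr d e) V x h = CL-sound Γ-valid e V x (CL-sound Γ-valid d V x h)
  CL-sound Γ-valid (∧-intro d e) V x h = CL-sound Γ-valid d V x h , CL-sound Γ-valid e V x h
  CL-sound Γ-valid (∨-elim {χ = χ} d e) V x (y , z , a , b , y⋏z≼x) =
    up (⟦ χ ⟧ V) (meet (⟦ χ ⟧ V) (CL-sound Γ-valid d V y a) (CL-sound Γ-valid e V z b)) y⋏z≼x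
  CL-sound Γ-valid (⇒-congˡ d e) V x h =
    λ z z∈s → h z (to (s-resp-≐ x (λ w → mk⇔ (CL-sound Γ-valid e V w) (CL-sound Γ-valid d V w)) z) z∈s)
  CL-sound Γ-valid (⇒-congʳ d e) V x h z z∈s = CL-sound Γ-valid d V z (h z z∈s)

  Γ₅-valid : IntersectionFrame F → ∀ {φ ψ} → Γ₅ φ ψ → Validates F φ ψ
  Γ₅-valid ∩↑ g-refl V x _ z z∈s = proj₁ (proj₁ (∩↑ x (V 0) z) z∈s)
  Γ₅-valid ∩↑ g-mp V x (x⊩p , x⊩p⇒q) = x⊩p⇒q x (proj₂ (∩↑ x (V 0) x) (x⊩p , idem x))
  Γ₅-valid ∩↑ g-k V x x⊩p z z∈s = up (V 0) x⊩p (proj₂ (proj₁ (∩↑ x (V 1) z) z∈s))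

module Lindenbaum (c ℓ : Level) where
  X : Set c
  X = Lift c Fm

  _≈_ : X → X → Set ℓ
  x ≈ y = Lift ℓ ((lower x ⊢ lower y) × (lower y ⊢ lower x))

  semilattice : IdempotentCommutativeMonoid c ℓ
  semilattice = record
    { Carrier = X ; _≈_ = _≈_ ; _∙_ = λ x y → lift (lower x ∨' lower y) ; ε = lift ⊥'
    ; isIdempotentCommutativeMonoid = record
      { isCommutativeMonoid = record
        { isMonoid = record
          { isSemigroup = record
            { isMagma = record
              { isEquivalence = record
                { refl  = lift (⊢-refl , ⊢-refl)
                ; sym   = λ (lift (a , b)) → lift (b , a)
                ; trans = λ (lift (a , b)) (lift (c , d)) → lift (tr a c , tr d b) }
              ; ∙-cong = λ (lift (a , b)) (lift (c , d)) → lift (∨-mono a c , ∨-mono b d) }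
            ; assoc = λ _ _ _ → lift ( ∨-elim (∨-mono ⊢-refl ∨-inl) (tr ∨-inr ∨-inr)
                                     , ∨-elim (tr ∨-inl ∨-inl) (∨-mono ∨-inr ⊢-refl)) }
          ; identity = (λ _ → lift (∨-elim ⊥-⊢ ⊢-refl , ∨-inr))
                     , (λ _ → lift (∨-elim ⊢-refl ⊥-⊢ , ∨-inl)) }
        ; comm = λ _ _ → lift (∨-elim ∨-inr ∨-inl , ∨-elim ∨-inr ∨-inl) }
      ; idem = λ _ → lift (∨-elim ⊢-refl ⊢-refl , ∨-inl) } }

  open SemilatticeNotions semilattice

  ≼⇒⊢ : ∀ {x y} → x ≼ y → lower y ⊢ lower x
  ≼⇒⊢ (lift (x∨y⊢x , _)) = tr ∨-inr x∨y⊢x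

  ⊢⇒≼ : ∀ {x y} → lower y ⊢ lower x → x ≼ y
  ⊢⇒≼ y⊢x = lift (∨-elim ⊢-refl y⊢x , ∨-inl)

  provable : Fm → Filter
  provable φ = record
    { _∋_    = λ x → Lift (c ⊔ ℓ) (lower x ⊢ φ)
    ; up     = λ (lift x⊢φ) x≼y → lift (tr (≼⇒⊢ x≼y) x⊢φ)
    ; has-𝟙  = lift ⊥-⊢
    ; meet   = λ (lift x⊢φ) (lift y⊢φ) → lift (∨-elim x⊢φ y⊢φ)
    }

  _∩↑_ : Filter → X → Filter
  a ∩↑ x = record
    { _∋_    = λ z → a ∋ z × x ≼ z
    ; up     = λ (z∈a , x≼z) z≼w → up a z∈a z≼w , ⊢⇒≼ (tr (≼⇒⊢ z≼w) (≼⇒⊢ x≼z))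
    ; has-𝟙  = has-𝟙 a , ⊢⇒≼ ⊥-⊢
    ; meet   = λ (z∈a , x≼z) (w∈a , x≼w) → meet a z∈a w∈a , ⊢⇒≼ (∨-elim (≼⇒⊢ x≼z) (≼⇒⊢ x≼w))
    }

  -- s-meet splits z ∈ a ∩ ↑(x ∨ y) as (z ∧ x) ∨ (z ∧ y), which needs distributivity.
  frame : SelectionLFrame c ℓ
  frame = record
    { semilattice = semilattice
    ; s      = λ x a → a ∩↑ x
    ; s-𝟙    = λ a z → (λ (_ , 𝟙≼z) → lift (≼⇒⊢ 𝟙≼z , ⊥-⊢))
                     , (λ (lift (z⊢⊥ , _)) → up a (has-𝟙 a) (⊢⇒≼ z⊢⊥) , ⊢⇒≼ z⊢⊥)
    ; s-anti = λ a x≼y z (z∈a , y≼z) → z∈a , ⊢⇒≼ (tr (≼⇒⊢ y≼z) (≼⇒⊢ x≼y))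
    ; s-meet = λ x y a z (z∈a , x⋏y≼z) →
        lift (lower z ∧' lower x) , lift (lower z ∧' lower y)
        , (up a z∈a (⊢⇒≼ ∧-fst) , ⊢⇒≼ ∧-snd)
        , (up a z∈a (⊢⇒≼ ∧-fst) , ⊢⇒≼ ∧-snd)
        , ⊢⇒≼ (tr (∧-intro ⊢-refl (≼⇒⊢ x⋏y≼z)) ∧-distribˡ-∨)
    ; s-ext  = λ x a b a≐b z (z∈a , x≼z) → proj₁ (a≐b z) z∈a , x≼z
    }

  frame-intersection : IntersectionFrame frame
  frame-intersection x a z = (λ h → h) , (λ h → h)

  open Semantics frame

  canonical : Valuation
  canonical n = provable (var n)

  truth-lemma : ∀ φ x → (canonical , x ⊩ φ) ⇔ (lower x ⊢ φ)
  truth-lemma (var n) x = mk⇔ lower lift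
  truth-lemma ⊤' x = mk⇔ (λ _ → ⊢-⊤) (λ _ → tt)
  truth-lemma ⊥' x = mk⇔ (λ (lift (lift (x⊢⊥ , _))) → x⊢⊥) (λ x⊢⊥ → lift (lift (x⊢⊥ , ⊥-⊢)))
  truth-lemma (φ ∧' ψ) x = mk⇔
    (λ (x⊩φ , x⊩ψ) → ∧-intro (to (truth-lemma φ x) x⊩φ) (to (truth-lemma ψ x) x⊩ψ))
    (λ x⊢φ∧ψ → from (truth-lemma φ x) (tr x⊢φ∧ψ ∧-fst) , from (truth-lemma ψ x) (tr x⊢φ∧ψ ∧-snd))
  truth-lemma (φ ∨' ψ) x = mk⇔
    (λ (y , z , y⊩φ , z⊩ψ , y∨z≼x) →
       tr (≼⇒⊢ y∨z≼x) (∨-mono (to (truth-lemma φ y) y⊩φ) (to (truth-lemma ψ z) z⊩ψ)))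
    (λ x⊢φ∨ψ → lift φ , lift ψ , from (truth-lemma φ (lift φ)) ⊢-refl
                              , from (truth-lemma ψ (lift ψ)) ⊢-refl , ⊢⇒≼ x⊢φ∨ψ)
  truth-lemma (φ ⇒' ψ) x = mk⇔
    (λ x⊩φ⇒ψ → ⊢-curry (to (truth-lemma ψ x∧φ)
                 (x⊩φ⇒ψ x∧φ (from (truth-lemma φ x∧φ) ∧-snd , ⊢⇒≼ ∧-fst))))
    (λ x⊢φ⇒ψ z (z⊩φ , x≼z) → from (truth-lemma ψ z)
                 (tr (∧-intro (≼⇒⊢ x≼z) (to (truth-lemma φ z) z⊩φ)) (⊢-uncurry x⊢φ⇒ψ)))
    where
    x∧φ : X
    x∧φ = lift (lower x ∧' φ)

theorem5p20 : ∀ {c ℓ : Level} (φ ψ : Fm) →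
    (CL Γ₅ φ ψ → ∀ (F : SelectionLFrame c ℓ) → IntersectionFrame F → Validates F φ ψ)
    × ((∀ (F : SelectionLFrame c ℓ) → IntersectionFrame F → Validates F φ ψ) → CL Γ₅ φ ψ)
theorem5p20 {c} {ℓ} φ ψ = sound , complete
  where
  sound : CL Γ₅ φ ψ → ∀ (F : SelectionLFrame c ℓ) → IntersectionFrame F → Validates F φ ψ
  sound φ⊢ψ F ∩↑ = CL-sound (Γ₅-valid ∩↑) φ⊢ψ
    where open Soundness F

  complete : (∀ (F : SelectionLFrame c ℓ) → IntersectionFrame F → Validates F φ ψ) → CL Γ₅ φ ψ
  complete valid = to (truth-lemma ψ (lift φ))
    (valid frame frame-intersection canonical (lift φ) (from (truth-lemma φ (lift φ)) ⊢-refl))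
    where open Lindenbaum c ℓ
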